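{- For every integer $k\geq 3$ and every real $\varepsilon$ with $0<\varepsilon<1/k$, there exists $s_0=s_0(k,\varepsilon)$ such that the following holds. Let $\eta$ be a real number with $0<\eta<\frac{\varepsilon^k}{3^{k+2}k!}$ and let $n,s$ be positive integers with $s>s_0$ and $(1-\eta)ks\leq n\leq (1+\eta)ks+k-2$. Suppose that $\mathcal{F}\subseteq\binom{[n]}{k}$ satisfies $|\mathcal{F}|>\binom{ks+k-2}{k}-3\eta (ks)^k$. If $\mathcal{F}$ is shifted on $[n]$, then $\omega(\mathcal{F})\geq (1-\varepsilon)ks$.
   Context: $[n]=\{1,\dots,n\}$ and $\binom{[n]}{k}$ is the set of all $k$-element subsets of $[n]$. For $1\le x<y\le n$ and $\mathcal{F}\subseteq\binom{[n]}{k}$, the $(x,y)$-shift is $S_{x,y}(\mathcal{F})=\{S_{x,y}(F):F\in\mathcal{F}\}$, where $S_{x,y}(F)=(F\setminus\{y\})\cup\{x\}$ if $y\in F$, $x\notin F$ and $(F\setminus\{y\})\cup\{x\}\notin\mathcal{F}$, and $S_{x,y}(F)=F$ otherwise. For $Y\subseteq[n]$, $\mathcal{F}$ is shifted on $Y$ if $S_{i,j}(\mathcal{F})=\mathcal{F}$ for all $i<j$ with $\{i,j\}\subseteq Y$. $\omega(\mathcal{F})$ denotes the largest size of a set $U\subseteq[n]$ with $\binom{U}{k}\subseteq\mathcal{F}$ (the number of vertices of a largest complete subgraph of $\mathcal{F}$).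
   Formalization: The parameters ε and η range over the rationals instead of the reals. -}

module Defs where

open import Data.Nat as ℕ using (ℕ; zero; suc)
open import Data.Integer using (+_)
open import Data.Rational as ℚ using (ℚ; _/_; 1ℚ)
open import Data.Bool using (Bool; if_then_else_; _∧_; not)
open import Data.Fin using (Fin)
open import Data.Fin.Subset using (Subset; ∣_∣; _⊆_; _-_; _∪_; ⁅_⁆)
open import Data.Fin.Subset.Properties using (_∈?_)
open import Data.List using (List; map)
open import Data.List.Relation.Unary.All using (All)
import Data.List.Membership.Propositional as LMem
import Data.List.Membership.DecPropositional as LDec
open import Data.Vec.Properties using (≡-dec)
import Data.Bool.Properties as BoolP
open import Data.Product using (_×_)
open import Relation.Nullary using (does)
open import Relation.Binary.PropositionalEquality using (_≡_)

ℕ→ℚ : ℕ → ℚ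
ℕ→ℚ n = (+ n) / 1

_^ℚ_ : ℚ → ℕ → ℚ
q ^ℚ zero  = 1ℚ
q ^ℚ suc m = q ℚ.* (q ^ℚ m)

-- a family of subsets of [n] (here [n] = Fin n), given as a duplicate-free list
Family : ℕ → Set
Family n = List (Subset n)

_∈F_ : ∀ {n} → Subset n → Family n → Set
_∈F_ = LMem._∈_

_∈F?_ : ∀ {n} (G : Subset n) (𝓕 : Family n) → _
_∈F?_ {n} = LDec._∈?_ (≡-dec BoolP._≟_)

Uniform : ∀ {n} → ℕ → Family n → Set
Uniform k 𝓕 = All (λ G → ∣ G ∣ ≡ k) 𝓕

shiftSet : ∀ {n} → Family n → Fin n → Fin n → Subset n → Subset n
shiftSet 𝓕 x y G =
  if does (y ∈? G) ∧ not (does (x ∈? G)) ∧ not (does (((G - y) ∪ ⁅ x ⁆) ∈F? 𝓕))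
  then (G - y) ∪ ⁅ x ⁆
  else G

shiftFam : ∀ {n} → Fin n → Fin n → Family n → Family n
shiftFam x y 𝓕 = map (shiftSet 𝓕 x y) 𝓕

_≈F_ : ∀ {n} → Family n → Family n → Set
𝓕 ≈F 𝓖 = ∀ G → (G ∈F 𝓕 → G ∈F 𝓖) × (G ∈F 𝓖 → G ∈F 𝓕)

ShiftedOn : ∀ {n} → Subset n → Family n → Set
ShiftedOn {n} Y 𝓕 = (i j : Fin n) → i Data.Fin.< j →
  i Data.Fin.Subset.∈ Y → j Data.Fin.Subset.∈ Y → shiftFam i j 𝓕 ≈F 𝓕

CompleteOn : ∀ {n} → ℕ → Family n → Subset n → Set
CompleteOn k 𝓕 U = ∀ G → G ⊆ U → ∣ G ∣ ≡ k → G ∈F 𝓕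

-- Let K = ks, L = ⌊εK⌋ and U = {0, …, K − L − 1}; U is the required clique.
-- If some member H of 𝓕 misses U, every k-subset G of U lies in 𝓕: exchanging an element of H ∖ G,
-- which lies outside U, for a smaller element of G ∖ H is a shift, and repeating this turns H into G.
-- Otherwise every member of 𝓕 meets U, so |𝓕| ≤ C(n,k) − C(d,k) with d = n − K + L ≥ L − ηK.
-- The bounds (x − k + 1)^k ≤ k!·C(x,k) ≤ x^k and x^k − y^k ≤ k(x − y)x^(k−1) show that both
-- k!·(C(n,k) − C(K + k − 2,k)) and (L + 1)^k − k!·C(d,k) are at most e = k(ηK + k)(2K)^(k−1).
-- As (L + 1)^k > (εK)^k, the bounds on η and s give 2e + 3η·k!·K^k < (L + 1)^k, and this
-- contradicts |𝓕| > C(K + k − 2,k) − 3ηK^k.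

module Submission where

open import Defs
open import Data.Nat as ℕ using (ℕ; _∸_; _!)
open import Data.Nat.Combinatorics using (_C_)
open import Data.Rational as ℚ using (ℚ; 0ℚ; 1ℚ)
open import Data.Fin.Subset using (Subset; ∣_∣; ⊤)
open import Data.List using (length)
open import Data.List.Relation.Unary.Unique.Propositional using (Unique)
open import Data.Product using (Σ; ∃-syntax; _×_)

open import Data.Nat using (zero; suc; _+_; _*_; _^_; _≤_; _<_; _⊔_; z≤n; s≤s; ≤-pred; >-nonZero; >-nonZero⁻¹)
open import Data.Nat.Properties
open import Data.Nat.Induction using (<-wellFounded)
open import Data.Nat.DivMod using (_/_; m*[n/m]≡n)
open import Data.Nat.Combinatorics using (_P_; nCk≡nPk/k!; k>n⇒nCk≡0; nCk+nC[k+1]≡[n+1]C[k+1])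
open import Data.Nat.Combinatorics.Base using (_P′_)
open import Data.Nat.Combinatorics.Specification using (nPk≡n!/[n∸k]!; nP′k≡n!/[n∸k]!; k!∣nP′k)
open import Data.Nat.Tactic.RingSolver using (solve-∀)
open import Data.Integer as ℤ using (+_)
import Data.Integer.Properties as ℤP
import Data.Integer.Tactic.RingSolver as ℤ-Solver
open import Data.Rational using (toℚᵘ)
import Data.Rational.Properties as ℚP
open import Data.Rational.Unnormalised as ℚᵘ using (mkℚᵘ; _≃_; *≡*)
import Data.Rational.Unnormalised.Properties as ℚᵘP
open import Data.Fin as Fin using (Fin; zero; suc)
open import Data.Fin.Properties using (injective⇒≤)
open import Data.Fin.Subset using (inside; outside; ⊥; _∩_; _─_; _-_; _∪_; ⁅_⁆; _⊆_; _∈_; _∉_; Nonempty; Empty)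
open import Data.Fin.Subset.Properties
  using (∣⊥∣≡0; ∉⊥; ∈⊤; x∈p∩q⁺; x∈p∩q⁻; x∈p∪q⁻; p⊆p∪q; q⊆p∪q; p─q⊆p; x∈p∧x∉q⇒x∈p─q; x∈p∧x≢y⇒x∈p-y;
         x∈⁅x⁆; x∈⁅y⁆⇒x≡y; drop-there; ⊆-antisym; p⊂q⇒∣p∣<∣q∣; nonempty?; _∈?_)
open import Data.Vec using ([]; _∷_; here; there)
open import Data.Vec.Properties using (∷-injectiveʳ)
open import Data.List using (List; []; _∷_; [_]; _++_; map; lookup)
open import Data.List.Properties using (length-++; length-map)
open import Data.List.Membership.Propositional using (find)
open import Data.List.Membership.Propositional.Properties using (∈-map⁺; ∈-map⁻; ∈-++⁺ˡ; ∈-++⁺ʳ; ∈-lookup)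
open import Data.List.Relation.Binary.Subset.Propositional using () renaming (_⊆_ to _⊆ₗ_)
open import Data.List.Relation.Unary.All as All using (All; []; _∷_)
open import Data.List.Relation.Unary.All.Properties using (++⁺; map⁺; ¬All⇒Any¬)
open import Data.List.Relation.Unary.Any as Any using (here; there)
open import Data.List.Relation.Unary.Any.Properties using (lookup-index)
open import Data.List.Relation.Unary.AllPairs using ([]; _∷_)
import Data.List.Relation.Unary.Unique.Propositional.Properties as Unique
open import Data.Product using (_,_; proj₁; proj₂)
open import Data.Sum using (inj₁; inj₂)
open import Data.Empty using () renaming (⊥ to False)
open import Function using (_∘_)
open import Induction.WellFounded using (Acc; acc)
open import Level using (0ℓ)
open import Relation.Nullary using (yes; no; contradiction)
open import Relation.Nullary.Decidable using (dec-true; dec-false; dec⇒maybe)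
open import Relation.Binary.PropositionalEquality using (_≡_; refl; sym; trans; cong; cong₂; subst; module ≡-Reasoning)
import Tactic.RingSolver as RingSolver
open import Tactic.RingSolver.Core.AlmostCommutativeRing using (AlmostCommutativeRing; fromCommutativeRing)

-- Natural numbers and powers in ℚ

ℚ-ring : AlmostCommutativeRing 0ℓ 0ℓ
ℚ-ring = fromCommutativeRing ℚP.+-*-commutativeRing (λ x → dec⇒maybe (0ℚ ℚP.≟ x))

toℚᵘ-ℕ→ℚ : ∀ n → toℚᵘ (ℕ→ℚ n) ≃ mkℚᵘ (+ n) 0
toℚᵘ-ℕ→ℚ n = ℚP.toℚᵘ-fromℚᵘ (mkℚᵘ (+ n) 0)

ℕ→ℚ-+ : ∀ a b → ℕ→ℚ (a + b) ≡ ℕ→ℚ a ℚ.+ ℕ→ℚ b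
ℕ→ℚ-+ a b = ℚP.toℚᵘ-injective (begin-equality
  toℚᵘ (ℕ→ℚ (a + b))              ≃⟨ toℚᵘ-ℕ→ℚ (a + b) ⟩
  mkℚᵘ (+ a ℤ.+ + b) 0            ≃⟨ *≡* (identity (+ a) (+ b)) ⟩
  mkℚᵘ (+ a) 0 ℚᵘ.+ mkℚᵘ (+ b) 0  ≃⟨ ℚᵘP.+-cong (toℚᵘ-ℕ→ℚ a) (toℚᵘ-ℕ→ℚ b) ⟨
  toℚᵘ (ℕ→ℚ a) ℚᵘ.+ toℚᵘ (ℕ→ℚ b)  ≃⟨ ℚP.toℚᵘ-homo-+ (ℕ→ℚ a) (ℕ→ℚ b) ⟨
  toℚᵘ (ℕ→ℚ a ℚ.+ ℕ→ℚ b)          ∎)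
  where
  open ℚᵘP.≤-Reasoning
  identity : ∀ x y → (x ℤ.+ y) ℤ.* + 1 ≡ (x ℤ.* + 1 ℤ.+ y ℤ.* + 1) ℤ.* + 1
  identity = ℤ-Solver.solve-∀

ℕ→ℚ-* : ∀ a b → ℕ→ℚ (a * b) ≡ ℕ→ℚ a ℚ.* ℕ→ℚ b
ℕ→ℚ-* a b = ℚP.toℚᵘ-injective (begin-equality
  toℚᵘ (ℕ→ℚ (a * b))              ≃⟨ toℚᵘ-ℕ→ℚ (a * b) ⟩
  mkℚᵘ (+ (a * b)) 0              ≃⟨ *≡* (cong (ℤ._* + 1) (ℤP.pos-* a b)) ⟩
  mkℚᵘ (+ a) 0 ℚᵘ.* mkℚᵘ (+ b) 0  ≃⟨ ℚᵘP.*-cong (toℚᵘ-ℕ→ℚ a) (toℚᵘ-ℕ→ℚ b) ⟨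
  toℚᵘ (ℕ→ℚ a) ℚᵘ.* toℚᵘ (ℕ→ℚ b)  ≃⟨ ℚP.toℚᵘ-homo-* (ℕ→ℚ a) (ℕ→ℚ b) ⟨
  toℚᵘ (ℕ→ℚ a ℚ.* ℕ→ℚ b)          ∎)
  where open ℚᵘP.≤-Reasoning

ℕ→ℚ-^ : ∀ a k → ℕ→ℚ (a ^ k) ≡ ℕ→ℚ a ^ℚ k
ℕ→ℚ-^ a zero    = refl
ℕ→ℚ-^ a (suc k) = trans (ℕ→ℚ-* a (a ^ k)) (cong (ℕ→ℚ a ℚ.*_) (ℕ→ℚ-^ a k))

ℕ→ℚ-nonNeg : ∀ n → 0ℚ ℚ.≤ ℕ→ℚ n
ℕ→ℚ-nonNeg n = ℚP.nonNegative⁻¹ (ℕ→ℚ n) {{ℚP.normalize-nonNeg n 1}}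

ℕ→ℚ-pos : ∀ {n} → 0 < n → 0ℚ ℚ.< ℕ→ℚ n
ℕ→ℚ-pos {suc n} _ = ℚP.positive⁻¹ (ℕ→ℚ (suc n)) {{ℚP.normalize-pos (suc n) 1}}

*-monoʳ-≤-ℕ→ℚ : ∀ c {p q} → p ℚ.≤ q → p ℚ.* ℕ→ℚ c ℚ.≤ q ℚ.* ℕ→ℚ c
*-monoʳ-≤-ℕ→ℚ c = ℚP.*-monoʳ-≤-nonNeg (ℕ→ℚ c) {{ℚP.normalize-nonNeg c 1}}

ℕ→ℚ-mono-≤ : ∀ {a b} → a ≤ b → ℕ→ℚ a ℚ.≤ ℕ→ℚ b
ℕ→ℚ-mono-≤ {a} {b} a≤b = begin
  ℕ→ℚ a                  ≡⟨ ℚP.+-identityʳ (ℕ→ℚ a) ⟨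
  ℕ→ℚ a ℚ.+ 0ℚ           ≤⟨ ℚP.+-monoʳ-≤ (ℕ→ℚ a) (ℕ→ℚ-nonNeg (b ∸ a)) ⟩
  ℕ→ℚ a ℚ.+ ℕ→ℚ (b ∸ a)  ≡⟨ ℕ→ℚ-+ a (b ∸ a) ⟨
  ℕ→ℚ (a + (b ∸ a))      ≡⟨ cong ℕ→ℚ (m+[n∸m]≡n a≤b) ⟩
  ℕ→ℚ b                  ∎
  where open ℚP.≤-Reasoning

ℕ→ℚ-cancel-< : ∀ {a b} → ℕ→ℚ a ℚ.< ℕ→ℚ b → a < b
ℕ→ℚ-cancel-< a<b = ≰⇒> (λ b≤a → ℚP.<-irrefl refl (ℚP.<-≤-trans a<b (ℕ→ℚ-mono-≤ b≤a)))

ℕ→ℚ-∸ : ∀ {a b} → b ≤ a → ℕ→ℚ (a ∸ b) ≡ ℕ→ℚ a ℚ.- ℕ→ℚ b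
ℕ→ℚ-∸ {a} {b} b≤a = begin
  ℕ→ℚ (a ∸ b)                      ≡⟨ identity (ℕ→ℚ (a ∸ b)) (ℕ→ℚ b) ⟩
  ℕ→ℚ (a ∸ b) ℚ.+ ℕ→ℚ b ℚ.- ℕ→ℚ b  ≡⟨ cong (ℚ._- ℕ→ℚ b) (ℕ→ℚ-+ (a ∸ b) b) ⟨
  ℕ→ℚ (a ∸ b + b) ℚ.- ℕ→ℚ b        ≡⟨ cong (λ x → ℕ→ℚ x ℚ.- ℕ→ℚ b) (m∸n+n≡m b≤a) ⟩
  ℕ→ℚ a ℚ.- ℕ→ℚ b                  ∎
  where
  open ≡-Reasoning
  identity : ∀ x y → x ≡ x ℚ.+ y ℚ.- y
  identity = RingSolver.solve-∀ ℚ-ring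

ℕ→ℚ-∸-≤ : ∀ a b {δ} → 0ℚ ℚ.≤ δ → ℕ→ℚ a ℚ.≤ ℕ→ℚ b ℚ.+ δ → ℕ→ℚ (a ∸ b) ℚ.≤ δ
ℕ→ℚ-∸-≤ a b {δ} δ≥0 a≤b+δ with ≤-total b a
... | inj₁ b≤a = begin
  ℕ→ℚ (a ∸ b)            ≡⟨ ℕ→ℚ-∸ b≤a ⟩
  ℕ→ℚ a ℚ.- ℕ→ℚ b        ≤⟨ ℚP.+-monoˡ-≤ (ℚ.- ℕ→ℚ b) a≤b+δ ⟩
  ℕ→ℚ b ℚ.+ δ ℚ.- ℕ→ℚ b  ≡⟨ identity (ℕ→ℚ b) δ ⟩
  δ                      ∎
  where
  open ℚP.≤-Reasoning
  identity : ∀ x d → x ℚ.+ d ℚ.- x ≡ d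
  identity = RingSolver.solve-∀ ℚ-ring
... | inj₂ a≤b = subst (ℚ._≤ δ) (cong ℕ→ℚ (sym (m≤n⇒m∸n≡0 a≤b))) δ≥0

^ℚ-nonNeg : ∀ {x} k → 0ℚ ℚ.≤ x → 0ℚ ℚ.≤ x ^ℚ k
^ℚ-nonNeg zero    x≥0 = ℚP.nonNegative⁻¹ 1ℚ
^ℚ-nonNeg {x} (suc k) x≥0 = ℚP.nonNegative⁻¹ _
  {{ℚP.nonNeg*nonNeg⇒nonNeg x {{ℚ.nonNegative x≥0}} (x ^ℚ k) {{ℚ.nonNegative (^ℚ-nonNeg k x≥0)}}}}

^ℚ-pos : ∀ {x} k → 0ℚ ℚ.< x → 0ℚ ℚ.< x ^ℚ k
^ℚ-pos zero    x>0 = ℚP.positive⁻¹ 1ℚ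
^ℚ-pos {x} (suc k) x>0 = ℚP.positive⁻¹ _
  {{ℚP.pos*pos⇒pos x {{ℚ.positive x>0}} (x ^ℚ k) {{ℚ.positive (^ℚ-pos k x>0)}}}}

^ℚ-mono-≤ : ∀ {x y} k → 0ℚ ℚ.≤ x → x ℚ.≤ y → x ^ℚ k ℚ.≤ y ^ℚ k
^ℚ-mono-≤ zero    x≥0 x≤y = ℚP.≤-refl
^ℚ-mono-≤ {x} {y} (suc k) x≥0 x≤y = begin
  x ℚ.* x ^ℚ k  ≤⟨ ℚP.*-monoˡ-≤-nonNeg x {{ℚ.nonNegative x≥0}} (^ℚ-mono-≤ k x≥0 x≤y) ⟩
  x ℚ.* y ^ℚ k  ≤⟨ ℚP.*-monoʳ-≤-nonNeg (y ^ℚ k) {{ℚ.nonNegative (^ℚ-nonNeg k (ℚP.≤-trans x≥0 x≤y))}} x≤y ⟩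
  y ℚ.* y ^ℚ k  ∎
  where open ℚP.≤-Reasoning

^ℚ-mono-< : ∀ {x y} j → 0ℚ ℚ.≤ x → x ℚ.< y → x ^ℚ suc j ℚ.< y ^ℚ suc j
^ℚ-mono-< {x} {y} j x≥0 x<y = begin-strict
  x ℚ.* x ^ℚ j  ≤⟨ ℚP.*-monoˡ-≤-nonNeg x {{ℚ.nonNegative x≥0}} (^ℚ-mono-≤ j x≥0 (ℚP.<⇒≤ x<y)) ⟩
  x ℚ.* y ^ℚ j  <⟨ ℚP.*-monoˡ-<-pos (y ^ℚ j) {{ℚ.positive (^ℚ-pos j (ℚP.≤-<-trans x≥0 x<y))}} x<y ⟩
  y ℚ.* y ^ℚ j  ∎
  where open ℚP.≤-Reasoning

^ℚ-distribʳ-* : ∀ x y k → (x ℚ.* y) ^ℚ k ≡ x ^ℚ k ℚ.* y ^ℚ k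
^ℚ-distribʳ-* x y zero    = refl
^ℚ-distribʳ-* x y (suc k) = begin
  x ℚ.* y ℚ.* (x ℚ.* y) ^ℚ k       ≡⟨ cong (x ℚ.* y ℚ.*_) (^ℚ-distribʳ-* x y k) ⟩
  x ℚ.* y ℚ.* (x ^ℚ k ℚ.* y ^ℚ k)  ≡⟨ identity x y (x ^ℚ k) (y ^ℚ k) ⟩
  x ℚ.* x ^ℚ k ℚ.* (y ℚ.* y ^ℚ k)  ∎
  where
  open ≡-Reasoning
  identity : ∀ a b c d → a ℚ.* b ℚ.* (c ℚ.* d) ≡ a ℚ.* c ℚ.* (b ℚ.* d)
  identity = RingSolver.solve-∀ ℚ-ring

1≤p*↧p : ∀ {p} → 0ℚ ℚ.< p → 1ℚ ℚ.≤ p ℚ.* ℕ→ℚ (ℚ.↧ₙ p)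
1≤p*↧p {p@(ℚ.mkℚ ℤ.+[1+ a ] d _)} _ = subst (1ℚ ℚ.≤_) p*↧p≡1+a (ℕ→ℚ-mono-≤ {1} {suc a} (s≤s z≤n))
  where
  -- the cross-multiplied numerators of the two unnormalised fractions below
  identity : ∀ a d → (d + a * suc d) * 1 ≡ d * 1 + a * suc (d * 1)
  identity = solve-∀
  p*↧p≡1+a : ℕ→ℚ (suc a) ≡ p ℚ.* ℕ→ℚ (suc d)
  p*↧p≡1+a = ℚP.toℚᵘ-injective (begin-equality
    toℚᵘ (ℕ→ℚ (suc a))                      ≃⟨ toℚᵘ-ℕ→ℚ (suc a) ⟩
    mkℚᵘ (+ suc a) 0                        ≃⟨ *≡* (cong (λ n → + suc n) (identity a d)) ⟨
    mkℚᵘ (+ suc a) d ℚᵘ.* mkℚᵘ (+ suc d) 0  ≃⟨ ℚᵘP.*-congˡ {toℚᵘ p} (toℚᵘ-ℕ→ℚ (suc d)) ⟨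
    toℚᵘ p ℚᵘ.* toℚᵘ (ℕ→ℚ (suc d))          ≃⟨ ℚP.toℚᵘ-homo-* p (ℕ→ℚ (suc d)) ⟨
    toℚᵘ (p ℚ.* ℕ→ℚ (suc d))                ∎)
    where open ℚᵘP.≤-Reasoning
1≤p*↧p {ℚ.mkℚ (+ 0)      _ _} (ℚ.*<* (ℤ.+<+ ()))
1≤p*↧p {ℚ.mkℚ ℤ.-[1+ _ ] _ _} (ℚ.*<* ())

∃-floor : ∀ {x} K → 0ℚ ℚ.≤ x → x ℚ.< ℕ→ℚ K →
  ∃[ L ] (L < K × ℕ→ℚ L ℚ.≤ x × x ℚ.< ℕ→ℚ (suc L))
∃-floor zero    x≥0 x<0 = contradiction (ℚP.≤-<-trans x≥0 x<0) (ℚP.<-irrefl refl)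
∃-floor {x} (suc K) x≥0 x<1+K with ℕ→ℚ K ℚP.≤? x
... | yes K≤x = K , n<1+n K , K≤x , x<1+K
... | no  K≰x with ∃-floor K x≥0 (ℚP.≰⇒> K≰x)
...   | L , L<K , L≤x , x<1+L = L , m<n⇒m<1+n L<K , L≤x , x<1+L

-- Binomial coefficients and powers

k!*nCk≡nP′k : ∀ {n k} → k ≤ n → k ! * (n C k) ≡ n P′ k
k!*nCk≡nP′k {n} {k} k≤n = begin
  k ! * (n C k)           ≡⟨ cong (k ! *_) (nCk≡nPk/k! k≤n) ⟩
  k ! * ((n P k) / k !)   ≡⟨ cong (λ x → k ! * (x / k !)) nPk≡nP′k ⟩
  k ! * ((n P′ k) / k !)  ≡⟨ m*[n/m]≡n (k!∣nP′k k≤n) ⟩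
  n P′ k                  ∎
  where
  open ≡-Reasoning
  instance _ = k !≢0
  nPk≡nP′k : n P k ≡ n P′ k
  nPk≡nP′k = trans (nPk≡n!/[n∸k]! k≤n) (sym (nP′k≡n!/[n∸k]! k≤n))

nP′k≤n^k : ∀ n k → n P′ k ≤ n ^ k
nP′k≤n^k n zero    = ≤-refl
nP′k≤n^k n (suc k) = *-mono-≤ (m∸n≤m n k) (nP′k≤n^k n k)

[n∸j]^[1+j]≤nP′[1+j] : ∀ n j → (n ∸ j) ^ suc j ≤ n P′ suc j
[n∸j]^[1+j]≤nP′[1+j] n zero    = ≤-refl
[n∸j]^[1+j]≤nP′[1+j] n (suc j) = *-monoʳ-≤ (n ∸ suc j) (begin
  (n ∸ suc j) ^ suc j  ≤⟨ ^-monoˡ-≤ (suc j) (∸-monoʳ-≤ n (n≤1+n j)) ⟩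
  (n ∸ j) ^ suc j      ≤⟨ [n∸j]^[1+j]≤nP′[1+j] n j ⟩
  n P′ suc j           ∎)
  where open ≤-Reasoning

k!*nCk≤n^k : ∀ n k → k ! * (n C k) ≤ n ^ k
k!*nCk≤n^k n k with k ≤? n
... | yes k≤n = ≤-trans (≤-reflexive (k!*nCk≡nP′k k≤n)) (nP′k≤n^k n k)
... | no  k≰n = begin
  k ! * (n C k)  ≡⟨ cong (k ! *_) (k>n⇒nCk≡0 (≰⇒> k≰n)) ⟩
  k ! * 0        ≡⟨ *-zeroʳ (k !) ⟩
  0              ≤⟨ z≤n ⟩
  n ^ k          ∎
  where open ≤-Reasoning

[n∸j]^[1+j]≤[1+j]!*nC[1+j] : ∀ n j → (n ∸ j) ^ suc j ≤ suc j ! * (n C suc j)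
[n∸j]^[1+j]≤[1+j]!*nC[1+j] n j with suc j ≤? n
... | yes k≤n = ≤-trans ([n∸j]^[1+j]≤nP′[1+j] n j) (≤-reflexive (sym (k!*nCk≡nP′k k≤n)))
... | no  k≰n = begin
  (n ∸ j) ^ suc j  ≡⟨ cong (_^ suc j) (m≤n⇒m∸n≡0 (≤-pred (≰⇒> k≰n))) ⟩
  0                ≤⟨ z≤n ⟩
  _                ∎
  where open ≤-Reasoning

[a+c]^[1+j]≤a^[1+j]+[1+j]*c*[a+c]^j : ∀ a c j → (a + c) ^ suc j ≤ a ^ suc j + suc j * c * (a + c) ^ j
[a+c]^[1+j]≤a^[1+j]+[1+j]*c*[a+c]^j a c zero    = ≤-reflexive (identity a c)
  where
  identity : ∀ a c → (a + c) * 1 ≡ a * 1 + 1 * c * 1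
  identity = solve-∀
[a+c]^[1+j]≤a^[1+j]+[1+j]*c*[a+c]^j a c (suc j) = begin
  (a + c) * (a + c) ^ suc j                                          ≤⟨ *-monoʳ-≤ (a + c) ([a+c]^[1+j]≤a^[1+j]+[1+j]*c*[a+c]^j a c j) ⟩
  (a + c) * (a ^ suc j + suc j * c * (a + c) ^ j)                    ≡⟨ expand a c (a ^ suc j) ((a + c) ^ j) (suc j) ⟩
  a * a ^ suc j + c * a ^ suc j + suc j * c * (a + c) ^ suc j        ≤⟨ +-monoˡ-≤ _ (+-monoʳ-≤ (a * a ^ suc j) (*-monoʳ-≤ c (^-monoˡ-≤ (suc j) (m≤m+n a c)))) ⟩
  a * a ^ suc j + c * (a + c) ^ suc j + suc j * c * (a + c) ^ suc j  ≡⟨ collect (a * a ^ suc j) c ((a + c) ^ suc j) (suc j) ⟩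
  a * a ^ suc j + suc (suc j) * c * (a + c) ^ suc j                  ∎
  where
  open ≤-Reasoning
  expand : ∀ a c p q m → (a + c) * (p + m * c * q) ≡ a * p + c * p + m * c * ((a + c) * q)
  expand = solve-∀
  collect : ∀ p c q m → p + c * q + m * c * q ≡ p + suc m * c * q
  collect = solve-∀

x^[1+j]≤y^[1+j]+[1+j]*[x∸y]*x^j : ∀ x y j → x ^ suc j ≤ y ^ suc j + suc j * (x ∸ y) * x ^ j
x^[1+j]≤y^[1+j]+[1+j]*[x∸y]*x^j x y j with ≤-total y x
... | inj₁ y≤x = subst (λ z → z ^ suc j ≤ y ^ suc j + suc j * (x ∸ y) * z ^ j) (m+[n∸m]≡n y≤x)
  ([a+c]^[1+j]≤a^[1+j]+[1+j]*c*[a+c]^j y (x ∸ y) j) 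
... | inj₂ x≤y = ≤-trans (^-monoˡ-≤ (suc j) x≤y) (m≤m+n _ _)

x^[1+j]≤[1+j]!*yC[1+j]+[1+j]*[x∸[y∸j]]*x^j : ∀ x y j →
  x ^ suc j ≤ suc j ! * (y C suc j) + suc j * (x ∸ (y ∸ j)) * x ^ j
x^[1+j]≤[1+j]!*yC[1+j]+[1+j]*[x∸[y∸j]]*x^j x y j =
  ≤-trans (x^[1+j]≤y^[1+j]+[1+j]*[x∸y]*x^j x (y ∸ j) j) (+-monoˡ-≤ _ ([n∸j]^[1+j]≤[1+j]!*nC[1+j] y j))

[m*n]^k≡m^k*n^k : ∀ m n k → (m * n) ^ k ≡ m ^ k * n ^ k
[m*n]^k≡m^k*n^k m n zero    = refl
[m*n]^k≡m^k*n^k m n (suc k) = trans (cong (m * n *_) ([m*n]^k≡m^k*n^k m n k)) (identity m n (m ^ k) (n ^ k))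
  where
  identity : ∀ a b c d → a * b * (c * d) ≡ a * c * (b * d)
  identity = solve-∀

8*[k*2^j]≤3^[k+2]*k! : ∀ j → 8 * (suc j * 2 ^ j) ≤ 3 ^ (suc j + 2) * suc j !
8*[k*2^j]≤3^[k+2]*k! j = begin
  8 * (suc j * 2 ^ j)        ≡⟨ identity (suc j) (2 ^ j) ⟩
  8 * 2 ^ j * suc j          ≤⟨ *-mono-≤ (*-mono-≤ (m≤m+n 8 19) (^-monoˡ-≤ j (n≤1+n 2))) (m≤m*n (suc j) (j !) {{j !≢0}}) ⟩
  27 * 3 ^ j * suc j !       ≡⟨ cong (_* suc j !) 27*3^j≡3^[j+3] ⟩
  3 ^ (suc j + 2) * suc j !  ∎
  where
  open ≤-Reasoning
  identity : ∀ k p → 8 * (k * p) ≡ 8 * p * k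
  identity = solve-∀
  identity′ : ∀ p → 3 * (p * 9) ≡ 27 * p
  identity′ = solve-∀
  27*3^j≡3^[j+3] : 27 * 3 ^ j ≡ 3 ^ (suc j + 2)
  27*3^j≡3^[j+3] = sym (trans (cong (3 *_) (^-distribˡ-+-* 3 j 2)) (identity′ (3 ^ j)))

absorb-error : ∀ {a p r x y e} → 2 ≤ a → 4 * e ≤ r → p ≤ x + e → r ≤ y + e → a * p + r ≤ a * (x + y)
absorb-error {a} {p} {r} {x} {y} {e} 2≤a 4e≤r p≤x+e r≤y+e = *-cancelˡ-≤ 2 (+-cancelʳ-≤ (a * r) _ _ (begin
  2 * (a * p + r) + a * r          ≡⟨ identity₁ a p r ⟩
  2 * (a * p) + 2 * r + a * r      ≤⟨ +-monoˡ-≤ (a * r) (+-monoʳ-≤ (2 * (a * p)) (*-monoˡ-≤ r 2≤a)) ⟩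
  2 * (a * p) + a * r + a * r      ≡⟨ identity₂ a p r ⟩
  2 * (a * (p + r))                ≤⟨ *-monoʳ-≤ 2 (*-monoʳ-≤ a (+-mono-≤ p≤x+e r≤y+e)) ⟩
  2 * (a * (x + e + (y + e)))      ≡⟨ identity₃ a x y e ⟩
  2 * (a * (x + y)) + a * (4 * e)  ≤⟨ +-monoʳ-≤ (2 * (a * (x + y))) (*-monoʳ-≤ a 4e≤r) ⟩
  2 * (a * (x + y)) + a * r        ∎))
  where
  open ≤-Reasoning
  identity₁ : ∀ a p r → 2 * (a * p + r) + a * r ≡ 2 * (a * p) + 2 * r + a * r
  identity₁ = solve-∀
  identity₂ : ∀ a p r → 2 * (a * p) + a * r + a * r ≡ 2 * (a * (p + r))
  identity₂ = solve-∀
  identity₃ : ∀ a x y e → 2 * (a * (x + e + (y + e))) ≡ 2 * (a * (x + y)) + a * (4 * e)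
  identity₃ = solve-∀

-- Counting k-subsets

module _ {a} {A : Set a} where

  lookup-injective : ∀ {xs : List A} → Unique xs → ∀ {i j} → lookup xs i ≡ lookup xs j → i ≡ j
  lookup-injective (x∉xs ∷ _)   {zero}  {zero}  _  = refl
  lookup-injective (x∉xs ∷ _)   {zero}  {suc j} eq = contradiction eq (All.lookup x∉xs (∈-lookup j))
  lookup-injective (x∉xs ∷ _)   {suc i} {zero}  eq = contradiction (sym eq) (All.lookup x∉xs (∈-lookup i))
  lookup-injective (_ ∷ unique) {suc i} {suc j} eq = cong suc (lookup-injective unique eq)

  Unique⇒length-≤ : ∀ {xs ys : List A} → Unique xs → xs ⊆ₗ ys → length xs ≤ length ys
  Unique⇒length-≤ {xs} {ys} unique xs⊆ys = injective⇒≤ injective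
    where
    position : Fin (length xs) → Fin (length ys)
    position i = Any.index (xs⊆ys (∈-lookup i))
    injective : ∀ {i j} → position i ≡ position j → i ≡ j
    injective {i} {j} eq = lookup-injective unique (begin
      lookup xs i             ≡⟨ lookup-index (xs⊆ys (∈-lookup i)) ⟩
      lookup ys (position i)  ≡⟨ cong (lookup ys) eq ⟩
      lookup ys (position j)  ≡⟨ lookup-index (xs⊆ys (∈-lookup j)) ⟨
      lookup xs j             ∎)
      where open ≡-Reasoning

kSubsets : (k n : ℕ) → List (Subset n)
kSubsets zero    n       = [ ⊥ ]
kSubsets (suc k) zero    = []
kSubsets (suc k) (suc n) = map (inside ∷_) (kSubsets k n) ++ map (outside ∷_) (kSubsets (suc k) n)

length-kSubsets : ∀ k n → length (kSubsets k n) ≡ n C k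
length-kSubsets zero    n       = refl
length-kSubsets (suc k) zero    = refl
length-kSubsets (suc k) (suc n) = begin
  length (map (inside ∷_) (kSubsets k n) ++ map (outside ∷_) (kSubsets (suc k) n))
    ≡⟨ length-++ (map (inside ∷_) (kSubsets k n)) ⟩
  length (map (inside ∷_) (kSubsets k n)) + length (map (outside ∷_) (kSubsets (suc k) n))
    ≡⟨ cong₂ _+_ (length-map (inside ∷_) (kSubsets k n)) (length-map (outside ∷_) (kSubsets (suc k) n)) ⟩
  length (kSubsets k n) + length (kSubsets (suc k) n)
    ≡⟨ cong₂ _+_ (length-kSubsets k n) (length-kSubsets (suc k) n) ⟩
  n C k + n C suc k
    ≡⟨ nCk+nC[k+1]≡[n+1]C[k+1] n k ⟩
  suc n C suc k ∎
  where open ≡-Reasoning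

∣p∣≡0⇒p≡⊥ : ∀ {n} {p : Subset n} → ∣ p ∣ ≡ 0 → p ≡ ⊥
∣p∣≡0⇒p≡⊥ {p = []}          _ = refl
∣p∣≡0⇒p≡⊥ {p = outside ∷ p} e = cong (outside ∷_) (∣p∣≡0⇒p≡⊥ e)

∈-kSubsets : ∀ {n} k (G : Subset n) → ∣ G ∣ ≡ k → G ∈F kSubsets k n
∈-kSubsets zero    G             ∣G∣≡0 = here (∣p∣≡0⇒p≡⊥ ∣G∣≡0)
∈-kSubsets (suc k) (inside ∷ G)  ∣G∣≡k = ∈-++⁺ˡ (∈-map⁺ (inside ∷_) (∈-kSubsets k G (suc-injective ∣G∣≡k)))
∈-kSubsets (suc k) (outside ∷ G) ∣G∣≡k = ∈-++⁺ʳ _ (∈-map⁺ (outside ∷_) (∈-kSubsets (suc k) G ∣G∣≡k))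

kSubsets-uniform : ∀ k n → Uniform k (kSubsets k n)
kSubsets-uniform zero    n       = ∣⊥∣≡0 n ∷ []
kSubsets-uniform (suc k) zero    = []
kSubsets-uniform (suc k) (suc n) = ++⁺
  (map⁺ (All.map (cong suc) (kSubsets-uniform k n)))
  (map⁺ (kSubsets-uniform (suc k) n))

kSubsets-unique : ∀ k n → Unique (kSubsets k n)
kSubsets-unique zero    n       = [] ∷ []
kSubsets-unique (suc k) zero    = []
kSubsets-unique (suc k) (suc n) = Unique.++⁺
  (Unique.map⁺ ∷-injectiveʳ (kSubsets-unique k n))
  (Unique.map⁺ ∷-injectiveʳ (kSubsets-unique (suc k) n))
  disjoint
  where
  disjoint : ∀ {G} → G ∈F map (inside ∷_) (kSubsets k n) × G ∈F map (outside ∷_) (kSubsets (suc k) n) → False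
  disjoint (G∈ins , G∈outs) with ∈-map⁻ (inside ∷_) G∈ins | ∈-map⁻ (outside ∷_) G∈outs
  ... | _ , _ , refl | _ , _ , ()

first : ∀ {n} → ℕ → Subset n
first zero            = ⊥
first {zero}  (suc m) = []
first {suc n} (suc m) = inside ∷ first m

∣first∣ : ∀ {n m} → m ≤ n → ∣ first {n} m ∣ ≡ m
∣first∣ {n} {zero}  _         = ∣⊥∣≡0 n
∣first∣ {suc n} {suc m} (s≤s m≤n) = cong suc (∣first∣ m≤n)

first-initial : ∀ {n m} {i j : Fin n} → i ∈ first m → j ∉ first m → i Fin.< j
first-initial {m = zero}  i∈ _ = contradiction i∈ ∉⊥
first-initial {m = suc m} {zero}  {zero}  _          j∉ = contradiction here j∉
first-initial {m = suc m} {zero}  {suc j} _          _  = s≤s z≤n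
first-initial {m = suc m} {suc i} {zero}  _          j∉ = contradiction here j∉
first-initial {m = suc m} {suc i} {suc j} (there i∈) j∉ = s≤s (first-initial {m = m} i∈ (j∉ ∘ there))

avoiding : ℕ → (k n : ℕ) → List (Subset n)
avoiding zero    k n       = kSubsets k n
avoiding (suc m) k zero    = kSubsets k zero
avoiding (suc m) k (suc n) = map (outside ∷_) (avoiding m k n)

length-avoiding : ∀ m k n → length (avoiding m k n) ≡ (n ∸ m) C k
length-avoiding zero    k n       = length-kSubsets k n
length-avoiding (suc m) k zero    = length-kSubsets k zero
length-avoiding (suc m) k (suc n) = trans (length-map (outside ∷_) (avoiding m k n)) (length-avoiding m k n)

avoiding-unique : ∀ m k n → Unique (avoiding m k n)
avoiding-unique zero    k n       = kSubsets-unique k n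
avoiding-unique (suc m) k zero    = kSubsets-unique k zero
avoiding-unique (suc m) k (suc n) = Unique.map⁺ ∷-injectiveʳ (avoiding-unique m k n)

avoiding-uniform : ∀ m k n → Uniform k (avoiding m k n)
avoiding-uniform zero    k n       = kSubsets-uniform k n
avoiding-uniform (suc m) k zero    = kSubsets-uniform k zero
avoiding-uniform (suc m) k (suc n) = map⁺ (avoiding-uniform m k n)

avoiding-misses-first : ∀ m k n → All (λ G → Empty (G ∩ first m)) (avoiding m k n)
avoiding-misses-first zero    k n       = All.universal (λ G (i , i∈G∩⊥) → ∉⊥ (proj₂ (x∈p∩q⁻ G ⊥ i∈G∩⊥))) _
avoiding-misses-first (suc m) k zero    = All.universal (λ { _ (() , _) }) _
avoiding-misses-first (suc m) k (suc n) = map⁺ (All.map outside∷-misses (avoiding-misses-first m k n))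
  where
  outside∷-misses : ∀ {G} → Empty (G ∩ first m) → Empty ((outside ∷ G) ∩ first (suc m))
  outside∷-misses misses (suc i , there i∈) = misses (i , i∈)

transversal-bound : ∀ {n k} m (𝓕 : Family n) → Unique 𝓕 → Uniform k 𝓕 →
  All (λ H → Nonempty (H ∩ first m)) 𝓕 → length 𝓕 + (n ∸ m) C k ≤ n C k
transversal-bound {n} {k} m 𝓕 unique uniform meets = begin
  length 𝓕 + (n ∸ m) C k              ≡⟨ cong (_+_ (length 𝓕)) (length-avoiding m k n) ⟨
  length 𝓕 + length (avoiding m k n)  ≡⟨ length-++ 𝓕 ⟨
  length (𝓕 ++ avoiding m k n)        ≤⟨ Unique⇒length-≤ (Unique.++⁺ unique (avoiding-unique m k n) disjoint) ⊆kSubsets ⟩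
  length (kSubsets k n)               ≡⟨ length-kSubsets k n ⟩
  n C k                               ∎
  where
  open ≤-Reasoning
  disjoint : ∀ {G} → G ∈F 𝓕 × G ∈F avoiding m k n → False
  disjoint (G∈𝓕 , G∈avoiding) = All.lookup (avoiding-misses-first m k n) G∈avoiding (All.lookup meets G∈𝓕)
  ⊆kSubsets : 𝓕 ++ avoiding m k n ⊆ₗ kSubsets k n
  ⊆kSubsets {G} G∈ = ∈-kSubsets k G (All.lookup (++⁺ uniform (avoiding-uniform m k n)) G∈)

-- Shifting

x∈p─q⁻ : ∀ {n} {x : Fin n} (p q : Subset n) → x ∈ p ─ q → x ∈ p × x ∉ q
x∈p─q⁻ (_ ∷ p) (outside ∷ q) here       = here , λ ()
x∈p─q⁻ (_ ∷ p) (_       ∷ q) (there x∈) with x∈p─q⁻ p q x∈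
... | x∈p , x∉q = there x∈p , x∉q ∘ drop-there

Empty[p─q]⇒p⊆q : ∀ {n} {p q : Subset n} → Empty (p ─ q) → p ⊆ q
Empty[p─q]⇒p⊆q {q = q} empty {x} x∈p with x ∈? q
... | yes x∈q = x∈q
... | no  x∉q = contradiction (x , x∈p∧x∉q⇒x∈p─q x∈p x∉q) empty

p⊆q∧∣p∣≡∣q∣⇒p≡q : ∀ {n} {p q : Subset n} → p ⊆ q → ∣ p ∣ ≡ ∣ q ∣ → p ≡ q
p⊆q∧∣p∣≡∣q∣⇒p≡q {p = p} {q} p⊆q ∣p∣≡∣q∣ = ⊆-antisym p⊆q (Empty[p─q]⇒p⊆q q─p-empty)
  where
  q─p-empty : Empty (q ─ p)
  q─p-empty (x , x∈q─p) with x∈p─q⁻ q p x∈q─p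
  ... | x∈q , x∉p = <⇒≢ (p⊂q⇒∣p∣<∣q∣ (p⊆q , x , x∈q , x∉p)) ∣p∣≡∣q∣

Nonempty[p─q]⇒Nonempty[q─p] : ∀ {n} {p q : Subset n} → ∣ p ∣ ≡ ∣ q ∣ → Nonempty (p ─ q) → Nonempty (q ─ p)
Nonempty[p─q]⇒Nonempty[q─p] {p = p} {q} ∣p∣≡∣q∣ (x , x∈p─q) with nonempty? (q ─ p)
... | yes q─p-nonempty = q─p-nonempty
... | no  q─p-empty    = contradiction (subst (x ∈_) (sym q≡p) (proj₁ (x∈p─q⁻ p q x∈p─q))) (proj₂ (x∈p─q⁻ p q x∈p─q))
  where q≡p = p⊆q∧∣p∣≡∣q∣⇒p≡q (Empty[p─q]⇒p⊆q q─p-empty) (sym ∣p∣≡∣q∣)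

∣p─[q-y∪⁅x⁆]∣<∣p─q∣ : ∀ {n} {p q : Subset n} {x y} → x ∈ p ─ q → y ∉ p → ∣ p ─ ((q - y) ∪ ⁅ x ⁆) ∣ < ∣ p ─ q ∣
∣p─[q-y∪⁅x⁆]∣<∣p─q∣ {p = p} {q} {x} {y} x∈p─q y∉p = p⊂q⇒∣p∣<∣q∣ (shrinks , x , x∈p─q , x∉)
  where
  q′ = (q - y) ∪ ⁅ x ⁆
  shrinks : p ─ q′ ⊆ p ─ q
  shrinks {i} i∈p─q′ with x∈p─q⁻ p q′ i∈p─q′ | i ∈? q
  ... | i∈p , i∉q′ | no  i∉q = x∈p∧x∉q⇒x∈p─q i∈p i∉q
  ... | i∈p , i∉q′ | yes i∈q = contradiction (p⊆p∪q ⁅ x ⁆ (x∈p∧x≢y⇒x∈p-y i∈q (λ { refl → y∉p i∈p }))) i∉q′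
  x∉ : x ∉ p ─ q′
  x∉ x∈p─q′ = proj₂ (x∈p─q⁻ p q′ x∈p─q′) (q⊆p∪q (q - y) ⁅ x ⁆ (x∈⁅x⁆ x))

shift-closed : ∀ {n} {𝓕 : Family n} → ShiftedOn ⊤ 𝓕 → ∀ {x y H} → x Fin.< y →
  H ∈F 𝓕 → y ∈ H → x ∉ H → ((H - y) ∪ ⁅ x ⁆) ∈F 𝓕
shift-closed {𝓕 = 𝓕} shifted {x} {y} {H} x<y H∈𝓕 y∈H x∉H with ((H - y) ∪ ⁅ x ⁆) ∈F? 𝓕
... | yes H′∈𝓕 = H′∈𝓕
... | no  H′∉𝓕 = proj₁ (shifted x y x<y ∈⊤ ∈⊤ _)
  (subst (_∈F shiftFam x y 𝓕) H↦H′ (∈-map⁺ (shiftSet 𝓕 x y) H∈𝓕))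
  where
  H↦H′ : shiftSet 𝓕 x y H ≡ (H - y) ∪ ⁅ x ⁆
  H↦H′ rewrite dec-true (y ∈? H) y∈H | dec-false (x ∈? H) x∉H | dec-false (((H - y) ∪ ⁅ x ⁆) ∈F? 𝓕) H′∉𝓕 = refl

module _ {n k} {𝓕 : Family n} (shifted : ShiftedOn ⊤ 𝓕) (uniform : Uniform k 𝓕)
         {U : Subset n} (initial : ∀ {i j} → i ∈ U → j ∉ U → i Fin.< j)
         {G : Subset n} (G⊆U : G ⊆ U) (∣G∣≡k : ∣ G ∣ ≡ k) where

  shift-towards : ∀ {H} → Acc ℕ._<_ ∣ G ─ H ∣ → H ∈F 𝓕 → (∀ {i} → i ∈ H → i ∈ U → i ∈ G) → G ∈F 𝓕
  shift-towards {H} (acc smaller) H∈𝓕 H∩U⊆G with nonempty? (G ─ H)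
  ... | no  G─H-empty = subst (_∈F 𝓕) (sym G≡H) H∈𝓕
    where G≡H = p⊆q∧∣p∣≡∣q∣⇒p≡q (Empty[p─q]⇒p⊆q G─H-empty) (trans ∣G∣≡k (sym (All.lookup uniform H∈𝓕)))
  ... | yes (x , x∈G─H) with Nonempty[p─q]⇒Nonempty[q─p] (trans ∣G∣≡k (sym (All.lookup uniform H∈𝓕))) (x , x∈G─H)
  ...   | y , y∈H─G = shift-towards (smaller (∣p─[q-y∪⁅x⁆]∣<∣p─q∣ x∈G─H y∉G))
                        (shift-closed shifted (initial (G⊆U x∈G) y∉U) H∈𝓕 y∈H x∉H) H′∩U⊆G
    where
    x∈G = proj₁ (x∈p─q⁻ G H x∈G─H)
    x∉H = proj₂ (x∈p─q⁻ G H x∈G─H)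
    y∈H = proj₁ (x∈p─q⁻ H G y∈H─G)
    y∉G = proj₂ (x∈p─q⁻ H G y∈H─G)
    y∉U : y ∉ U
    y∉U y∈U = y∉G (H∩U⊆G y∈H y∈U)
    H′∩U⊆G : ∀ {i} → i ∈ (H - y) ∪ ⁅ x ⁆ → i ∈ U → i ∈ G
    H′∩U⊆G {i} i∈H′ i∈U with x∈p∪q⁻ (H - y) ⁅ x ⁆ i∈H′
    ... | inj₁ i∈H-y = H∩U⊆G (p─q⊆p H ⁅ y ⁆ i∈H-y) i∈U
    ... | inj₂ i∈⁅x⁆ = subst (_∈ G) (sym (x∈⁅y⁆⇒x≡y x i∈⁅x⁆)) x∈G

avoider⇒complete : ∀ {n k} {𝓕 : Family n} {U H : Subset n} → ShiftedOn ⊤ 𝓕 → Uniform k 𝓕 →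
  (∀ {i j} → i ∈ U → j ∉ U → i Fin.< j) → H ∈F 𝓕 → Empty (H ∩ U) → CompleteOn k 𝓕 U
avoider⇒complete shifted uniform initial H∈𝓕 H∩U-empty G G⊆U ∣G∣≡k =
  shift-towards shifted uniform initial G⊆U ∣G∣≡k (<-wellFounded _) H∈𝓕
    (λ i∈H i∈U → contradiction (_ , x∈p∩q⁺ (i∈H , i∈U)) H∩U-empty)

large⇒complete-first : ∀ {n k} m (𝓕 : Family n) → Unique 𝓕 → Uniform k 𝓕 → ShiftedOn ⊤ 𝓕 →
  n C k < length 𝓕 + (n ∸ m) C k → CompleteOn k 𝓕 (first m)
large⇒complete-first m 𝓕 unique uniform shifted large with All.all? (λ H → nonempty? (H ∩ first m)) 𝓕
... | yes all-meet = contradiction (transversal-bound m 𝓕 unique uniform all-meet) (<⇒≱ large)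
... | no ¬all-meet with find (¬All⇒Any¬ (λ H → nonempty? (H ∩ first m)) 𝓕 ¬all-meet)
...   | H , H∈𝓕 , H∩first-empty = avoider⇒complete shifted uniform (first-initial {m = m}) H∈𝓕 H∩first-empty

-- The counting inequality

-- In the application K = ks, L = ⌊εK⌋, t bounds the distance of n from [K, K + k − 2],
-- m = K − L is the size of the clique and d = n − m the number of points outside it.
module BinomialExcess {j K t L n : ℕ}
  (b≤K : suc L ≤ K) (n≤N+t : n ≤ K + (suc j ∸ 2) + t) (K≤n+t : K ≤ n + t)
  (deviation-bound : (t + suc j) * (3 ^ (suc j + 2) * suc j !) * K ^ j < 2 * suc L ^ suc j) where

  private
    k b N u W m d : ℕ
    k = suc j
    b = suc L
    N = K + (k ∸ 2)
    u = t + k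
    W = K ^ j
    m = K ∸ L
    d = n ∸ m

  e : ℕ
  e = k * u * (2 ^ j * W)

  4e<b^k : 4 * e < b ^ k
  4e<b^k = *-cancelˡ-< 2 (4 * e) (b ^ k) (begin-strict
    2 * (4 * e)                  ≡⟨ identity₁ k u (2 ^ j) W ⟩
    8 * (k * 2 ^ j) * (u * W)    ≤⟨ *-monoˡ-≤ (u * W) (8*[k*2^j]≤3^[k+2]*k! j) ⟩
    3 ^ (k + 2) * k ! * (u * W)  ≡⟨ identity₂ (3 ^ (k + 2) * k !) u W ⟩
    u * (3 ^ (k + 2) * k !) * W  <⟨ deviation-bound ⟩
    2 * b ^ k                    ∎)
    where
    open ≤-Reasoning
    identity₁ : ∀ k u p w → 2 * (4 * (k * u * (p * w))) ≡ 8 * (k * p) * (u * w)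
    identity₁ = solve-∀
    identity₂ : ∀ q u w → q * (u * w) ≡ u * q * w
    identity₂ = solve-∀

  u<b : u < b
  u<b = *-cancelʳ-< W u b (begin-strict
    u * W                      ≤⟨ m≤n*m (u * W) (4 * (k * 2 ^ j)) {{>-nonZero 1≤4*[k*2^j]}} ⟩
    4 * (k * 2 ^ j) * (u * W)  ≡⟨ identity k u (2 ^ j) W ⟩
    4 * e                      <⟨ 4e<b^k ⟩
    b * b ^ j                  ≤⟨ *-monoʳ-≤ b (^-monoˡ-≤ j b≤K) ⟩
    b * W                      ∎)
    where
    open ≤-Reasoning
    1≤4*[k*2^j] : 1 ≤ 4 * (k * 2 ^ j)
    1≤4*[k*2^j] = *-mono-≤ {1} {4} (s≤s z≤n) (*-mono-≤ {1} {k} (s≤s z≤n) (m^n>0 2 j))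
    identity : ∀ k u p w → 4 * (k * p) * (u * w) ≡ 4 * (k * u * (p * w))
    identity = solve-∀

  t≤L : t ≤ L
  t≤L = ≤-trans (m≤m+n t k) (≤-pred u<b)

  m≤n : m ≤ n
  m≤n = m≤n+o⇒m∸n≤o K L (begin
    K      ≤⟨ K≤n+t ⟩
    n + t  ≤⟨ +-monoʳ-≤ n t≤L ⟩
    n + L  ≡⟨ +-comm n L ⟩
    L + n  ∎)
    where open ≤-Reasoning

  u≤K : u ≤ K
  u≤K = ≤-trans (<⇒≤ u<b) b≤K

  n≤2K : n ≤ 2 * K
  n≤2K = begin
    n                ≤⟨ n≤N+t ⟩
    K + (k ∸ 2) + t  ≤⟨ +-monoˡ-≤ t (+-monoʳ-≤ K (m∸n≤m k 2)) ⟩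
    K + k + t        ≡⟨ identity K k t ⟩
    K + u            ≤⟨ +-monoʳ-≤ K u≤K ⟩
    K + K            ≡⟨ cong (_+_ K) (+-identityʳ K) ⟨
    2 * K            ∎
    where
    open ≤-Reasoning
    identity : ∀ K k t → K + k + t ≡ K + (t + k)
    identity = solve-∀

  gap-n : n ∸ (N ∸ j) ≤ u
  gap-n = m≤n+o⇒m∸n≤o n (N ∸ j) (begin
    n                  ≤⟨ n≤N+t ⟩
    N + t              ≤⟨ +-monoˡ-≤ t (m≤n+m∸n N j) ⟩
    j + (N ∸ j) + t    ≤⟨ ≤-reflexive (identity j (N ∸ j) t) ⟩
    (N ∸ j) + (t + j)  ≤⟨ +-monoʳ-≤ (N ∸ j) (+-monoʳ-≤ t (n≤1+n j)) ⟩
    (N ∸ j) + u        ∎)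
    where
    open ≤-Reasoning
    identity : ∀ j x t → j + x + t ≡ x + (t + j)
    identity = solve-∀

  gap-b : b ∸ (d ∸ j) ≤ u
  gap-b = m≤n+o⇒m∸n≤o b (d ∸ j) (begin
    suc L                  ≤⟨ s≤s L≤d+t ⟩
    suc (d + t)            ≤⟨ s≤s (+-monoˡ-≤ t (m≤n+m∸n d j)) ⟩
    suc (j + (d ∸ j) + t)  ≡⟨ identity j (d ∸ j) t ⟩
    (d ∸ j) + u            ∎)
    where
    open ≤-Reasoning
    identity : ∀ j x t → suc (j + x + t) ≡ x + (t + suc j)
    identity = solve-∀
    L≤d+t : L ≤ d + t
    L≤d+t = +-cancelˡ-≤ m L (d + t) (begin
      m + L        ≡⟨ m∸n+n≡m {K} {L} (<⇒≤ b≤K) ⟩ 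
      K            ≤⟨ K≤n+t ⟩
      n + t        ≡⟨ cong (_+ t) (m+[n∸m]≡n m≤n) ⟨
      m + d + t    ≡⟨ +-assoc m d t ⟩
      m + (d + t)  ∎)

  power-bound : ∀ {x y} → x ∸ (y ∸ j) ≤ u → x ≤ 2 * K → x ^ k ≤ k ! * (y C k) + e
  power-bound {x} {y} gap x≤2K = begin
    x ^ k                                      ≤⟨ x^[1+j]≤[1+j]!*yC[1+j]+[1+j]*[x∸[y∸j]]*x^j x y j ⟩
    k ! * (y C k) + k * (x ∸ (y ∸ j)) * x ^ j  ≤⟨ +-monoʳ-≤ (k ! * (y C k)) (*-mono-≤ (*-monoʳ-≤ k gap) x^j≤2^jW) ⟩
    k ! * (y C k) + e                          ∎
    where
    open ≤-Reasoning
    x^j≤2^jW : x ^ j ≤ 2 ^ j * W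
    x^j≤2^jW = ≤-trans (^-monoˡ-≤ j x≤2K) (≤-reflexive ([m*n]^k≡m^k*n^k 2 K j))

  excess : ∀ {f} → 3 ^ (k + 1) * k ! * (N C k) < 3 ^ (k + 1) * k ! * f + b ^ k → n C k < f + d C k
  excess {f} large = ≰⇒> λ f+dCk≤nCk → <-irrefl refl (begin-strict
    c * (N C k) + c * (d C k)            <⟨ +-monoˡ-< (c * (d C k)) large ⟩
    c * f + b ^ k + c * (d C k)          ≡⟨ identity₁ c f (b ^ k) (d C k) ⟩
    c * (f + d C k) + b ^ k              ≤⟨ +-monoˡ-≤ (b ^ k) (*-monoʳ-≤ c f+dCk≤nCk) ⟩
    c * (n C k) + b ^ k                  ≡⟨ cong (_+ b ^ k) (*-assoc A (k !) (n C k)) ⟩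
    A * (k ! * (n C k)) + b ^ k          ≤⟨ absorb-error {x = k ! * (N C k)} {y = k ! * (d C k)} {e = e} 2≤A (<⇒≤ 4e<b^k) upper lower ⟩
    A * (k ! * (N C k) + k ! * (d C k))  ≡⟨ identity₂ A (k !) (N C k) (d C k) ⟩
    c * (N C k) + c * (d C k)            ∎)
    where
    open ≤-Reasoning
    A = 3 ^ (k + 1)
    c = A * k !
    2≤A : 2 ≤ A
    2≤A = ≤-trans (n≤1+n 2) (^-monoʳ-≤ 3 {1} {k + 1} (m≤n+m 1 k))
    upper : k ! * (n C k) ≤ k ! * (N C k) + e
    upper = ≤-trans (k!*nCk≤n^k n k) (power-bound gap-n n≤2K)
    lower : b ^ k ≤ k ! * (d C k) + e
    lower = power-bound gap-b (≤-trans b≤K (m≤n*m K 2))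
    identity₁ : ∀ c f p x → c * f + p + c * x ≡ c * (f + x) + p
    identity₁ = solve-∀
    identity₂ : ∀ a g x y → a * (g * x + g * y) ≡ a * g * x + a * g * y
    identity₂ = solve-∀

-- Rounding εks and the deviation of n

module NaturalBounds (j : ℕ) (ε η : ℚ) (n s : ℕ)
  (ε>0 : 0ℚ ℚ.< ε) (εk<1 : ε ℚ.* ℕ→ℚ (suc j) ℚ.< 1ℚ) (η>0 : 0ℚ ℚ.< η)
  (ηQ<E : η ℚ.* ℕ→ℚ (3 ^ (suc j + 2) * suc j !) ℚ.< ε ^ℚ suc j)
  (s₀<s : 3 ^ (suc j + 2) * suc j ! * ℚ.↧ₙ (ε ^ℚ suc j) < s)
  (lo : (1ℚ ℚ.- η) ℚ.* ℕ→ℚ (suc j * s) ℚ.≤ ℕ→ℚ n)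
  (hi : ℕ→ℚ n ℚ.≤ (1ℚ ℚ.+ η) ℚ.* ℕ→ℚ (suc j * s) ℚ.+ ℕ→ℚ (suc j ∸ 2)) where

  private
    k K N Q : ℕ
    k = suc j
    K = k * s
    N = K + (k ∸ 2)
    Q = 3 ^ (k + 2) * k !
    E : ℚ
    E = ε ^ℚ k
    Kℚ = ℕ→ℚ K
    W = K ^ j

    K>0 : 0ℚ ℚ.< Kℚ
    K>0 = ℕ→ℚ-pos (≤-trans (≤-trans (s≤s z≤n) s₀<s) (m≤n*m s k))

    E>0 : 0ℚ ℚ.< E
    E>0 = ^ℚ-pos k ε>0

    εK≥0 : 0ℚ ℚ.≤ ε ℚ.* Kℚ
    εK≥0 = ℚP.nonNegative⁻¹ _ {{ℚP.nonNeg*nonNeg⇒nonNeg ε {{ℚ.nonNegative (ℚP.<⇒≤ ε>0)}} Kℚ {{ℚ.nonNegative (ℚP.<⇒≤ K>0)}}}}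

    εK<K : ε ℚ.* Kℚ ℚ.< Kℚ
    εK<K = begin-strict
      ε ℚ.* Kℚ   <⟨ ℚP.*-monoˡ-<-pos Kℚ {{ℚ.positive K>0}} ε<1 ⟩
      1ℚ ℚ.* Kℚ  ≡⟨ ℚP.*-identityˡ Kℚ ⟩
      Kℚ         ∎
      where
      open ℚP.≤-Reasoning
      ε<1 : ε ℚ.< 1ℚ
      ε<1 = ℚP.≤-<-trans (begin
        ε            ≡⟨ ℚP.*-identityʳ ε ⟨
        ε ℚ.* 1ℚ     ≤⟨ ℚP.*-monoˡ-≤-nonNeg ε {{ℚ.nonNegative (ℚP.<⇒≤ ε>0)}} (ℕ→ℚ-mono-≤ {1} {k} (s≤s z≤n)) ⟩
        ε ℚ.* ℕ→ℚ k  ∎) εk<1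

    floor = ∃-floor K εK≥0 εK<K

  L : ℕ
  L = proj₁ floor

  b : ℕ
  b = suc L

  b≤K : b ≤ K
  b≤K = proj₁ (proj₂ floor)

  private
    L≤εK : ℕ→ℚ L ℚ.≤ ε ℚ.* Kℚ
    L≤εK = proj₁ (proj₂ (proj₂ floor))

    εK<b : ε ℚ.* Kℚ ℚ.< ℕ→ℚ b
    εK<b = proj₂ (proj₂ (proj₂ floor))

  clique-size : (1ℚ ℚ.- ε) ℚ.* Kℚ ℚ.≤ ℕ→ℚ (K ∸ L)
  clique-size = begin
    (1ℚ ℚ.- ε) ℚ.* Kℚ  ≡⟨ identity ε Kℚ ⟩
    Kℚ ℚ.- ε ℚ.* Kℚ    ≤⟨ ℚP.+-monoʳ-≤ Kℚ (ℚP.neg-antimono-≤ L≤εK) ⟩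
    Kℚ ℚ.- ℕ→ℚ L       ≡⟨ ℕ→ℚ-∸ (<⇒≤ b≤K) ⟨
    ℕ→ℚ (K ∸ L)        ∎
    where
    open ℚP.≤-Reasoning
    identity : ∀ e x → (1ℚ ℚ.- e) ℚ.* x ≡ x ℚ.- e ℚ.* x
    identity = RingSolver.solve-∀ ℚ-ring

  t : ℕ
  t = (n ∸ N) ⊔ (K ∸ n)

  n≤N+t : n ≤ N + t
  n≤N+t = ≤-trans (m≤n+m∸n n N) (+-monoʳ-≤ N (m≤m⊔n _ _))

  K≤n+t : K ≤ n + t
  K≤n+t = ≤-trans (m≤n+m∸n K n) (+-monoʳ-≤ n (m≤n⊔m _ _))

  private
    ηK≥0 : 0ℚ ℚ.≤ η ℚ.* Kℚ
    ηK≥0 = ℚP.nonNegative⁻¹ _ {{ℚP.nonNeg*nonNeg⇒nonNeg η {{ℚ.nonNegative (ℚP.<⇒≤ η>0)}} Kℚ {{ℚ.nonNegative (ℚP.<⇒≤ K>0)}}}}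

    t≤ηK : ℕ→ℚ t ℚ.≤ η ℚ.* Kℚ
    t≤ηK with ⊔-sel (n ∸ N) (K ∸ n)
    ... | inj₁ t≡n∸N = subst (λ x → ℕ→ℚ x ℚ.≤ η ℚ.* Kℚ) (sym t≡n∸N) (ℕ→ℚ-∸-≤ n N ηK≥0 (begin
      ℕ→ℚ n                              ≤⟨ hi ⟩
      (1ℚ ℚ.+ η) ℚ.* Kℚ ℚ.+ ℕ→ℚ (k ∸ 2)  ≡⟨ identity η Kℚ (ℕ→ℚ (k ∸ 2)) ⟩
      (Kℚ ℚ.+ ℕ→ℚ (k ∸ 2)) ℚ.+ η ℚ.* Kℚ  ≡⟨ cong (ℚ._+ η ℚ.* Kℚ) (ℕ→ℚ-+ K (k ∸ 2)) ⟨
      ℕ→ℚ N ℚ.+ η ℚ.* Kℚ                 ∎))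
      where
      open ℚP.≤-Reasoning
      identity : ∀ h x c → (1ℚ ℚ.+ h) ℚ.* x ℚ.+ c ≡ (x ℚ.+ c) ℚ.+ h ℚ.* x
      identity = RingSolver.solve-∀ ℚ-ring
    ... | inj₂ t≡K∸n = subst (λ x → ℕ→ℚ x ℚ.≤ η ℚ.* Kℚ) (sym t≡K∸n) (ℕ→ℚ-∸-≤ K n ηK≥0 (begin
      Kℚ                              ≡⟨ identity η Kℚ ⟩
      (1ℚ ℚ.- η) ℚ.* Kℚ ℚ.+ η ℚ.* Kℚ  ≤⟨ ℚP.+-monoˡ-≤ (η ℚ.* Kℚ) lo ⟩
      ℕ→ℚ n ℚ.+ η ℚ.* Kℚ              ∎))
      where
      open ℚP.≤-Reasoning
      identity : ∀ h x → x ≡ (1ℚ ℚ.- h) ℚ.* x ℚ.+ h ℚ.* x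
      identity = RingSolver.solve-∀ ℚ-ring

    EK^k<b^k : E ℚ.* ℕ→ℚ (K ^ k) ℚ.< ℕ→ℚ (b ^ k)
    EK^k<b^k = begin-strict
      E ℚ.* ℕ→ℚ (K ^ k)  ≡⟨ cong (E ℚ.*_) (ℕ→ℚ-^ K k) ⟩
      E ℚ.* Kℚ ^ℚ k      ≡⟨ ^ℚ-distribʳ-* ε Kℚ k ⟨
      (ε ℚ.* Kℚ) ^ℚ k    <⟨ ^ℚ-mono-< j εK≥0 εK<b ⟩
      ℕ→ℚ b ^ℚ k         ≡⟨ ℕ→ℚ-^ b k ⟨
      ℕ→ℚ (b ^ k)        ∎
      where open ℚP.≤-Reasoning

    ηQK^k<b^k : η ℚ.* ℕ→ℚ Q ℚ.* ℕ→ℚ (K ^ k) ℚ.< ℕ→ℚ (b ^ k)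
    ηQK^k<b^k = ℚP.<-trans (ℚP.*-monoˡ-<-pos (ℕ→ℚ (K ^ k)) {{ℚ.positive K^k>0}} ηQ<E) EK^k<b^k
      where
      K^k>0 : 0ℚ ℚ.< ℕ→ℚ (K ^ k)
      K^k>0 = subst (0ℚ ℚ.<_) (sym (ℕ→ℚ-^ K k)) (^ℚ-pos k K>0)

    kQ≤EK : ℕ→ℚ (k * Q) ℚ.≤ E ℚ.* Kℚ
    kQ≤EK = begin
      ℕ→ℚ (k * Q)                           ≡⟨ ℚP.*-identityˡ _ ⟨
      1ℚ ℚ.* ℕ→ℚ (k * Q)                    ≤⟨ *-monoʳ-≤-ℕ→ℚ (k * Q) (1≤p*↧p E>0) ⟩
      E ℚ.* ℕ→ℚ (ℚ.↧ₙ E) ℚ.* ℕ→ℚ (k * Q)    ≡⟨ ℚP.*-assoc E _ _ ⟩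
      E ℚ.* (ℕ→ℚ (ℚ.↧ₙ E) ℚ.* ℕ→ℚ (k * Q))  ≡⟨ cong (E ℚ.*_) (ℕ→ℚ-* (ℚ.↧ₙ E) (k * Q)) ⟨
      E ℚ.* ℕ→ℚ (ℚ.↧ₙ E * (k * Q))          ≤⟨ ℚP.*-monoˡ-≤-nonNeg E {{ℚ.nonNegative (ℚP.<⇒≤ E>0)}} (ℕ→ℚ-mono-≤ ↧E*kQ≤K) ⟩
      E ℚ.* Kℚ                              ∎
      where
      open ℚP.≤-Reasoning
      identity : ∀ d k q → d * (k * q) ≡ k * (q * d)
      identity = solve-∀
      ↧E*kQ≤K : ℚ.↧ₙ E * (k * Q) ≤ K
      ↧E*kQ≤K = ≤-trans (≤-reflexive (identity (ℚ.↧ₙ E) k Q)) (*-monoʳ-≤ k (<⇒≤ s₀<s))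

  deviation-bound : (t + k) * Q * W < 2 * b ^ k
  deviation-bound = ℕ→ℚ-cancel-< (begin-strict
    ℕ→ℚ ((t + k) * Q * W)                                    ≡⟨ cong ℕ→ℚ (split t k Q W) ⟩
    ℕ→ℚ (t * (Q * W) + k * Q * W)                            ≡⟨ ℕ→ℚ-+ (t * (Q * W)) _ ⟩
    ℕ→ℚ (t * (Q * W)) ℚ.+ ℕ→ℚ (k * Q * W)                    ≡⟨ cong₂ ℚ._+_ (ℕ→ℚ-* t (Q * W)) (ℕ→ℚ-* (k * Q) W) ⟩
    ℕ→ℚ t ℚ.* ℕ→ℚ (Q * W) ℚ.+ ℕ→ℚ (k * Q) ℚ.* ℕ→ℚ W          ≤⟨ ℚP.+-mono-≤ (*-monoʳ-≤-ℕ→ℚ (Q * W) t≤ηK) (*-monoʳ-≤-ℕ→ℚ W kQ≤EK) ⟩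
    η ℚ.* Kℚ ℚ.* ℕ→ℚ (Q * W) ℚ.+ E ℚ.* Kℚ ℚ.* ℕ→ℚ W          ≡⟨ cong₂ (λ x y → η ℚ.* Kℚ ℚ.* x ℚ.+ E ℚ.* Kℚ ℚ.* y) (ℕ→ℚ-* Q W) refl ⟩
    η ℚ.* Kℚ ℚ.* (ℕ→ℚ Q ℚ.* ℕ→ℚ W) ℚ.+ E ℚ.* Kℚ ℚ.* ℕ→ℚ W    ≡⟨ regroup η Kℚ (ℕ→ℚ Q) (ℕ→ℚ W) E ⟩
    η ℚ.* ℕ→ℚ Q ℚ.* (Kℚ ℚ.* ℕ→ℚ W) ℚ.+ E ℚ.* (Kℚ ℚ.* ℕ→ℚ W)  ≡⟨ cong (λ x → η ℚ.* ℕ→ℚ Q ℚ.* x ℚ.+ E ℚ.* x) (ℕ→ℚ-* K W) ⟨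
    η ℚ.* ℕ→ℚ Q ℚ.* ℕ→ℚ (K ^ k) ℚ.+ E ℚ.* ℕ→ℚ (K ^ k)        <⟨ ℚP.+-mono-< ηQK^k<b^k EK^k<b^k ⟩
    ℕ→ℚ (b ^ k) ℚ.+ ℕ→ℚ (b ^ k)                              ≡⟨ ℕ→ℚ-+ (b ^ k) (b ^ k) ⟨
    ℕ→ℚ (b ^ k + b ^ k)                                      ≡⟨ cong ℕ→ℚ (double (b ^ k)) ⟩
    ℕ→ℚ (2 * b ^ k)                                          ∎)
    where
    open ℚP.≤-Reasoning
    split : ∀ t k q w → (t + k) * q * w ≡ t * (q * w) + k * q * w
    split = solve-∀
    double : ∀ x → x + x ≡ 2 * x
    double = solve-∀
    regroup : ∀ h x q w e → h ℚ.* x ℚ.* (q ℚ.* w) ℚ.+ e ℚ.* x ℚ.* w ≡ h ℚ.* q ℚ.* (x ℚ.* w) ℚ.+ e ℚ.* (x ℚ.* w)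
    regroup = RingSolver.solve-∀ ℚ-ring

  density-bound : ∀ f → ℕ→ℚ (N C k) ℚ.- ℕ→ℚ 3 ℚ.* η ℚ.* (Kℚ ^ℚ k) ℚ.< ℕ→ℚ f →
    3 ^ (k + 1) * k ! * (N C k) < 3 ^ (k + 1) * k ! * f + b ^ k
  density-bound f dense = ℕ→ℚ-cancel-< (begin-strict
    ℕ→ℚ (c * (N C k))                                           ≡⟨ ℕ→ℚ-* c (N C k) ⟩
    ℕ→ℚ c ℚ.* ℕ→ℚ (N C k)                                         ≡⟨ split (ℕ→ℚ 3) (ℕ→ℚ c) (ℕ→ℚ (N C k)) η (Kℚ ^ℚ k) ⟩
    ℕ→ℚ c ℚ.* (ℕ→ℚ (N C k) ℚ.- ℕ→ℚ 3 ℚ.* η ℚ.* (Kℚ ^ℚ k))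
      ℚ.+ η ℚ.* (ℕ→ℚ 3 ℚ.* ℕ→ℚ c) ℚ.* (Kℚ ^ℚ k)                  <⟨ ℚP.+-mono-<-≤ (ℚP.*-monoʳ-<-pos (ℕ→ℚ c) {{ℚ.positive c>0}} dense) (ℚP.≤-reflexive 3c≡Q) ⟩
    ℕ→ℚ c ℚ.* ℕ→ℚ f ℚ.+ η ℚ.* ℕ→ℚ Q ℚ.* ℕ→ℚ (K ^ k)           <⟨ ℚP.+-monoʳ-< (ℕ→ℚ c ℚ.* ℕ→ℚ f) ηQK^k<b^k ⟩
    ℕ→ℚ c ℚ.* ℕ→ℚ f ℚ.+ ℕ→ℚ (b ^ k)                            ≡⟨ cong (ℚ._+ ℕ→ℚ (b ^ k)) (ℕ→ℚ-* c f) ⟨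
    ℕ→ℚ (c * f) ℚ.+ ℕ→ℚ (b ^ k)                              ≡⟨ ℕ→ℚ-+ (c * f) (b ^ k) ⟨
    ℕ→ℚ (c * f + b ^ k)                                    ∎)
    where
    open ℚP.≤-Reasoning
    c = 3 ^ (k + 1) * k !
    c>0 : 0ℚ ℚ.< ℕ→ℚ c
    c>0 = ℕ→ℚ-pos (>-nonZero⁻¹ c {{m*n≢0 (3 ^ (k + 1)) (k !) {{m^n≢0 3 (k + 1)}} {{k !≢0}}}})
    split : ∀ three c x h y → c ℚ.* x ≡ c ℚ.* (x ℚ.- three ℚ.* h ℚ.* y) ℚ.+ h ℚ.* (three ℚ.* c) ℚ.* y
    split = RingSolver.solve-∀ ℚ-ring
    3c≡Q : η ℚ.* (ℕ→ℚ 3 ℚ.* ℕ→ℚ c) ℚ.* (Kℚ ^ℚ k) ≡ η ℚ.* ℕ→ℚ Q ℚ.* ℕ→ℚ (K ^ k)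
    3c≡Q = cong₂ (λ x y → η ℚ.* x ℚ.* y)
      (trans (sym (ℕ→ℚ-* 3 c)) (cong ℕ→ℚ (sym Q≡3c))) (sym (ℕ→ℚ-^ K k))
      where
      Q≡3c : Q ≡ 3 * c
      Q≡3c = trans (cong (λ x → 3 ^ x * k !) (+-suc k 1)) (*-assoc 3 (3 ^ (k + 1)) (k !))

lemma2p3 : (k : ℕ) → 3 ℕ.≤ k → (ε : ℚ) → 0ℚ ℚ.< ε → ε ℚ.* ℕ→ℚ k ℚ.< 1ℚ →
  ∃[ s₀ ] ((η : ℚ) → 0ℚ ℚ.< η →
    η ℚ.* ℕ→ℚ ((3 ℕ.^ (k ℕ.+ 2)) ℕ.* (k !)) ℚ.< ε ^ℚ k →
    (n s : ℕ) → 1 ℕ.≤ n → 1 ℕ.≤ s → s₀ ℕ.< s →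
    (1ℚ ℚ.- η) ℚ.* ℕ→ℚ (k ℕ.* s) ℚ.≤ ℕ→ℚ n →
    ℕ→ℚ n ℚ.≤ (1ℚ ℚ.+ η) ℚ.* ℕ→ℚ (k ℕ.* s) ℚ.+ ℕ→ℚ (k ∸ 2) →
    (𝓕 : Family n) → Unique 𝓕 → Uniform k 𝓕 →
    ℕ→ℚ ((k ℕ.* s ℕ.+ (k ∸ 2)) C k) ℚ.- ℕ→ℚ 3 ℚ.* η ℚ.* (ℕ→ℚ (k ℕ.* s) ^ℚ k)
      ℚ.< ℕ→ℚ (length 𝓕) →
    ShiftedOn ⊤ 𝓕 →
    Σ (Subset n) (λ U → CompleteOn k 𝓕 U ×
      (1ℚ ℚ.- ε) ℚ.* ℕ→ℚ (k ℕ.* s) ℚ.≤ ℕ→ℚ ∣ U ∣))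
-- The threshold s₀ guarantees k·3^(k+2)·k! ≤ ε^k·ks (see kQ≤EK).
lemma2p3 (suc j) _ ε ε>0 εk<1 = 3 ^ (suc j + 2) * suc j ! * ℚ.↧ₙ (ε ^ℚ suc j) ,
  λ η η>0 ηQ<εᵏ n s _ _ s₀<s lo hi 𝓕 unique uniform dense shifted →
    let open NaturalBounds j ε η n s ε>0 εk<1 η>0 ηQ<εᵏ s₀<s lo hi
        open BinomialExcess b≤K n≤N+t K≤n+t deviation-bound using (m≤n; excess)
        m = suc j * s ∸ L
    in first m ,
       large⇒complete-first m 𝓕 unique uniform shifted (excess (density-bound (length 𝓕) dense)) ,
       subst (λ x → (1ℚ ℚ.- ε) ℚ.* ℕ→ℚ (suc j * s) ℚ.≤ ℕ→ℚ x) (sym (∣first∣ m≤n)) clique-size
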